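{- Let $(\mathcal P,\mathcal O)$ be a semitopology and let $\mathrm{vote},\mathrm{observe}:\mathcal P\to\mathbf 3$ be functions such that: (Observe?) for every $p\in\mathcal P$, $\mathrm{observe}(p)\to_w\mathsf{Quorum}\,\mathrm{vote}$ is valid; (Observe$\neg$?) for every $p$, $\neg\mathrm{observe}(p)\to_w\mathsf{Quorum}(\neg\mathrm{vote})$ is valid; (Observe!) for every $p$, $\mathsf{Quorum}\,\mathrm{vote}\to_s\mathrm{observe}(p)$ is valid; (Observe$\neg$!) for every $p$, $\mathsf{Quorum}(\neg\mathrm{vote})\to_s\neg\mathrm{observe}(p)$ is valid; (Correct) $\mathsf{Quorum}(\mathsf{TF}\circ\mathrm{vote})$ is valid; (3twined) for all $f,f':\mathcal P\to\mathbf 3$, $\mathsf{Quorum} f\wedge\mathsf{Quorum} f'\le\mathsf{Contraquorum}(f\wedge f')$. Then $\mathsf{Somewhere}(\mathsf T\circ\mathrm{observe})\wedge\mathsf{Somewhere}(\mathsf T\circ\neg\mathrm{observe})=\mathbf f$ (that is, it is not valid).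
   Context: Truth values: $\mathbf 3=\{\mathbf f,\mathbf b,\mathbf t\}$ totally ordered by $\mathbf f<\mathbf b<\mathbf t$; $\wedge,\vee$ are min and max, $\bigwedge,\bigvee$ are infimum and supremum. Negation: $\neg\mathbf t=\mathbf f$, $\neg\mathbf b=\mathbf b$, $\neg\mathbf f=\mathbf t$. Modalities: $\mathsf T x=\mathbf t$ if $x=\mathbf t$, else $\mathbf f$; $\mathsf{TF}x=\mathbf t$ if $x\in\{\mathbf t,\mathbf f\}$, else $\mathbf f$. Weak implication $x\to_w y:=\neg x\vee y$; strong implication $x\to_s y:=\neg x\vee\mathsf T y$. A truth value is valid iff it lies in $\{\mathbf t,\mathbf b\}$. Operations on $\mathbf 3$ are lifted pointwise to functions $\mathcal P\to\mathbf 3$ (e.g. $(\neg f)(p)=\neg f(p)$, $(f\wedge f')(p)=f(p)\wedge f'(p)$); $\circ$ is function composition. A semitopology $(\mathcal P,\mathcal O)$ is a set $\mathcal P$ with a family $\mathcal O$ of subsets containing $\mathcal P$ and closed under arbitrary (including empty) unions; $\mathcal O^{\neq\emptyset}$ is the set of nonempty members. For $f:\mathcal P\to\mathbf 3$: $\mathsf{Somewhere} f=\bigvee_p f(p)$, $\mathsf{Quorum} f=\bigvee_{O\in\mathcal O^{\neq\emptyset}}\bigwedge_{p\in O}f(p)$, $\mathsf{Contraquorum} f=\bigwedge_{O\in\mathcal O^{\neq\emptyset}}\bigvee_{p\in O}f(p)$. -}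

module Defs where

open import Data.Product using (Σ; ∃; _×_; _,_)
open import Data.Sum using (_⊎_)
open import Data.Unit using (⊤)
open import Data.Empty using (⊥)
open import Level using (Level; _⊔_) renaming (suc to lsuc)
open import Relation.Binary.PropositionalEquality using (_≡_)

data 𝟛 : Set where
  𝐟 𝐛 𝐭 : 𝟛

data _≤₃_ : 𝟛 → 𝟛 → Set where
  f≤ : ∀ {x} → 𝐟 ≤₃ x
  b≤b : 𝐛 ≤₃ 𝐛
  b≤t : 𝐛 ≤₃ 𝐭
  t≤t : 𝐭 ≤₃ 𝐭

infixr 7 _∧₃_
infixr 6 _∨₃_
infixr 5 _→w_ _→s_

_∧₃_ : 𝟛 → 𝟛 → 𝟛
𝐟 ∧₃ y = 𝐟
𝐛 ∧₃ 𝐟 = 𝐟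
𝐛 ∧₃ y = 𝐛
𝐭 ∧₃ y = y

_∨₃_ : 𝟛 → 𝟛 → 𝟛
𝐟 ∨₃ y = y
𝐛 ∨₃ 𝐭 = 𝐭
𝐛 ∨₃ y = 𝐛
𝐭 ∨₃ y = 𝐭

¬₃ : 𝟛 → 𝟛
¬₃ 𝐭 = 𝐟
¬₃ 𝐛 = 𝐛
¬₃ 𝐟 = 𝐭

T₃ : 𝟛 → 𝟛
T₃ 𝐭 = 𝐭
T₃ _ = 𝐟

TF₃ : 𝟛 → 𝟛
TF₃ 𝐛 = 𝐟
TF₃ _ = 𝐭

_→w_ : 𝟛 → 𝟛 → 𝟛
x →w y = ¬₃ x ∨₃ y

_→s_ : 𝟛 → 𝟛 → 𝟛
x →s y = ¬₃ x ∨₃ T₃ y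

Valid : 𝟛 → Set
Valid x = (x ≡ 𝐭) ⊎ (x ≡ 𝐛)

-- Suprema / infima in 𝟛 of an arbitrary "set of values" S : 𝟛 → Set,
-- stated relationally (least upper bound / greatest lower bound), since
-- arbitrary joins cannot be computed constructively.

IsSupOf : ∀ {ℓ} → (𝟛 → Set ℓ) → 𝟛 → Set ℓ
IsSupOf S v = (∀ w → S w → w ≤₃ v) × (∀ u → (∀ w → S w → w ≤₃ u) → v ≤₃ u)

IsInfOf : ∀ {ℓ} → (𝟛 → Set ℓ) → 𝟛 → Set ℓ
IsInfOf S v = (∀ w → S w → v ≤₃ w) × (∀ u → (∀ w → S w → u ≤₃ w) → u ≤₃ v)

record Semitopology : Set₁ where
  field
    P    : Set
    Open : (P → Set) → Set
    Open-ext   : ∀ (U V : P → Set) → (∀ p → U p → V p) → (∀ p → V p → U p) → Open U → Open V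
    Open-full  : Open (λ _ → ⊤)
    -- closed under arbitrary unions (including the empty union, I = ⊥)
    Open-union : ∀ (I : Set) (U : I → P → Set) → (∀ i → Open (U i)) → Open (λ p → Σ I (λ i → U i p))

module _ (S : Semitopology) where
  open Semitopology S

  _∧ᶠ_ : (P → 𝟛) → (P → 𝟛) → (P → 𝟛)
  (g ∧ᶠ h) p = g p ∧₃ h p

  IsSomewhere : (P → 𝟛) → 𝟛 → Set
  IsSomewhere g = IsSupOf (λ w → ∃ λ p → g p ≡ w)

  IsInfOn : (P → Set) → (P → 𝟛) → 𝟛 → Set
  IsInfOn O g = IsInfOf (λ w → ∃ λ p → O p × g p ≡ w)

  IsSupOn : (P → Set) → (P → 𝟛) → 𝟛 → Set
  IsSupOn O g = IsSupOf (λ w → ∃ λ p → O p × g p ≡ w)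

  NonemptyOpen : (P → Set) → Set
  NonemptyOpen O = Open O × ∃ λ p → O p

  IsQuorum : (P → 𝟛) → 𝟛 → Set₁
  IsQuorum g = IsSupOf (λ w → Σ (P → Set) λ O → NonemptyOpen O × IsInfOn O g w)

  IsContraquorum : (P → 𝟛) → 𝟛 → Set₁
  IsContraquorum g = IsInfOf (λ w → Σ (P → Set) λ O → NonemptyOpen O × IsSupOn O g w)

-- Observing t at p makes Quorum vote valid (Observe?), observing f at p' makes Quorum ¬vote
-- valid (Observe¬?), so by 3twined Contraquorum (vote ∧ ¬vote) is valid. But by Correct some
-- nonempty open O has vote ∈ {t, f} throughout, so vote ∧ ¬vote is f on O and the
-- contraquorum is f. Suprema and infima are relational, so their existence is only ¬¬-true;
-- since the conclusion is decidable, the whole argument runs under double negation.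
module Submission where

open import Defs
open import Function using (_∘_)
open import Relation.Binary.PropositionalEquality using (_≡_; _≢_; refl; subst; sym)
open import Data.Product using (∃; _×_; _,_)
open import Data.Sum using (inj₁; inj₂)
open import Data.Empty using (⊥; ⊥-elim)
open import Relation.Nullary using (¬_; Dec; yes; no)
open import Relation.Nullary.Decidable using (¬¬-excluded-middle)

x≤₃𝐭 : ∀ x → x ≤₃ 𝐭
x≤₃𝐭 𝐟 = f≤
x≤₃𝐭 𝐛 = b≤t
x≤₃𝐭 𝐭 = t≤t

x≤₃𝐟⇒x≡𝐟 : ∀ {x} → x ≤₃ 𝐟 → x ≡ 𝐟
x≤₃𝐟⇒x≡𝐟 f≤ = refl

≤₃-resp-≢𝐟 : ∀ {x y} → x ≤₃ y → x ≢ 𝐟 → y ≢ 𝐟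
≤₃-resp-≢𝐟 f≤  x≢𝐟 = ⊥-elim (x≢𝐟 refl)
≤₃-resp-≢𝐟 b≤b _   ()
≤₃-resp-≢𝐟 b≤t _   ()
≤₃-resp-≢𝐟 t≤t _   ()

∧₃-≢𝐟 : ∀ {x y} → x ≢ 𝐟 → y ≢ 𝐟 → x ∧₃ y ≢ 𝐟
∧₃-≢𝐟 {𝐟}      x≢𝐟 _   = x≢𝐟
∧₃-≢𝐟 {_} {𝐟}  _   y≢𝐟 = λ _ → y≢𝐟 refl
∧₃-≢𝐟 {𝐛} {𝐛}  _   _   = λ ()
∧₃-≢𝐟 {𝐛} {𝐭}  _   _   = λ ()
∧₃-≢𝐟 {𝐭} {𝐛}  _   _   = λ ()
∧₃-≢𝐟 {𝐭} {𝐭}  _   _   = λ ()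

∧₃≡𝐟 : ∀ {x y} → ¬ (x ≢ 𝐟 × y ≢ 𝐟) → x ∧₃ y ≡ 𝐟
∧₃≡𝐟 {𝐟}      _ = refl
∧₃≡𝐟 {𝐛} {𝐟}  _ = refl
∧₃≡𝐟 {𝐭} {𝐟}  _ = refl
∧₃≡𝐟 {𝐛} {𝐛}  h = ⊥-elim (h ((λ ()) , (λ ())))
∧₃≡𝐟 {𝐛} {𝐭}  h = ⊥-elim (h ((λ ()) , (λ ())))
∧₃≡𝐟 {𝐭} {𝐛}  h = ⊥-elim (h ((λ ()) , (λ ())))
∧₃≡𝐟 {𝐭} {𝐭}  h = ⊥-elim (h ((λ ()) , (λ ())))

T₃≢𝐟⇒≡𝐭 : ∀ {x} → T₃ x ≢ 𝐟 → x ≡ 𝐭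
T₃≢𝐟⇒≡𝐭 {𝐟} T≢𝐟 = ⊥-elim (T≢𝐟 refl)
T₃≢𝐟⇒≡𝐭 {𝐛} T≢𝐟 = ⊥-elim (T≢𝐟 refl)
T₃≢𝐟⇒≡𝐭 {𝐭} _   = refl

TF₃≢𝐟⇒x∧₃¬₃x≡𝐟 : ∀ {x} → TF₃ x ≢ 𝐟 → x ∧₃ ¬₃ x ≡ 𝐟
TF₃≢𝐟⇒x∧₃¬₃x≡𝐟 {𝐟} _    = refl
TF₃≢𝐟⇒x∧₃¬₃x≡𝐟 {𝐛} TF≢𝐟 = ⊥-elim (TF≢𝐟 refl)
TF₃≢𝐟⇒x∧₃¬₃x≡𝐟 {𝐭} _    = refl

Valid⇒≢𝐟 : ∀ {x} → Valid x → x ≢ 𝐟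
Valid⇒≢𝐟 (inj₁ refl) ()
Valid⇒≢𝐟 (inj₂ refl) ()

Valid-→w-𝐭 : ∀ {x y} → x ≡ 𝐭 → Valid (x →w y) → Valid y
Valid-→w-𝐭 {y = y} x≡𝐭 = subst (λ x → Valid (x →w y)) x≡𝐭

module _ {ℓ} (V : 𝟛 → Set ℓ) where

  sup-of-dec : Dec (V 𝐭) → Dec (V 𝐛) → ∃ (IsSupOf V)
  sup-of-dec (yes V𝐭) _        = 𝐭 , (λ w _ → x≤₃𝐭 w) , (λ _ ub → ub 𝐭 V𝐭)
  sup-of-dec (no ¬V𝐭) (yes V𝐛) = 𝐛 , bounded , (λ _ ub → ub 𝐛 V𝐛)
    where
    bounded : ∀ w → V w → w ≤₃ 𝐛
    bounded 𝐟 _   = f≤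
    bounded 𝐛 _   = b≤b
    bounded 𝐭 V𝐭 = ⊥-elim (¬V𝐭 V𝐭)
  sup-of-dec (no ¬V𝐭) (no ¬V𝐛) = 𝐟 , bounded , (λ _ _ → f≤)
    where
    bounded : ∀ w → V w → w ≤₃ 𝐟
    bounded 𝐟 _   = f≤
    bounded 𝐛 V𝐛 = ⊥-elim (¬V𝐛 V𝐛)
    bounded 𝐭 V𝐭 = ⊥-elim (¬V𝐭 V𝐭)

  inf-of-dec : Dec (V 𝐟) → Dec (V 𝐛) → ∃ (IsInfOf V)
  inf-of-dec (yes V𝐟) _        = 𝐟 , (λ _ _ → f≤) , (λ _ lb → lb 𝐟 V𝐟)
  inf-of-dec (no ¬V𝐟) (yes V𝐛) = 𝐛 , bounded , (λ _ lb → lb 𝐛 V𝐛)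
    where
    bounded : ∀ w → V w → 𝐛 ≤₃ w
    bounded 𝐟 V𝐟 = ⊥-elim (¬V𝐟 V𝐟)
    bounded 𝐛 _   = b≤b
    bounded 𝐭 _   = b≤t
  inf-of-dec (no ¬V𝐟) (no ¬V𝐛) = 𝐭 , bounded , (λ u _ → x≤₃𝐭 u)
    where
    bounded : ∀ w → V w → 𝐭 ≤₃ w
    bounded 𝐟 V𝐟 = ⊥-elim (¬V𝐟 V𝐟)
    bounded 𝐛 V𝐛 = ⊥-elim (¬V𝐛 V𝐛)
    bounded 𝐭 _   = t≤t

  sup-exists : ¬ ¬ ∃ (IsSupOf V)
  sup-exists k = ¬¬-excluded-middle λ V𝐭? → ¬¬-excluded-middle λ V𝐛? → k (sup-of-dec V𝐭? V𝐛?)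

  inf-exists : ¬ ¬ ∃ (IsInfOf V)
  inf-exists k = ¬¬-excluded-middle λ V𝐟? → ¬¬-excluded-middle λ V𝐛? → k (inf-of-dec V𝐟? V𝐛?)

  sup≢𝐟⇒∃≢𝐟 : ∀ {v} → IsSupOf V v → v ≢ 𝐟 → ¬ ¬ ∃ λ w → V w × w ≢ 𝐟
  sup≢𝐟⇒∃≢𝐟 (_ , least) v≢𝐟 k = v≢𝐟 (x≤₃𝐟⇒x≡𝐟 (least 𝐟 bounded))
    where
    bounded : ∀ w → V w → w ≤₃ 𝐟
    bounded 𝐟 _   = f≤
    bounded 𝐛 V𝐛 = ⊥-elim (k (𝐛 , V𝐛 , λ ()))
    bounded 𝐭 V𝐭 = ⊥-elim (k (𝐭 , V𝐭 , λ ()))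

  sup-of-all-𝐟 : ∀ {v} → IsSupOf V v → (∀ w → V w → w ≡ 𝐟) → v ≡ 𝐟
  sup-of-all-𝐟 (_ , least) all-𝐟 =
    x≤₃𝐟⇒x≡𝐟 (least 𝐟 λ w Vw → subst (_≤₃ 𝐟) (sym (all-𝐟 w Vw)) f≤)

module _ (S : Semitopology) where
  open Semitopology S

  ThreeTwined : Set₁
  ThreeTwined = ∀ (g h : P → 𝟛) (q q' c : 𝟛) → IsQuorum S g q → IsQuorum S h q'
              → IsContraquorum S (_∧ᶠ_ S g h) c → (q ∧₃ q') ≤₃ c

  somewhere-T₃≢𝐟⇒∃𝐭 : ∀ (g : P → 𝟛) {s} → IsSomewhere S (T₃ ∘ g) s → s ≢ 𝐟
                     → ¬ ¬ ∃ λ p → g p ≡ 𝐭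
  somewhere-T₃≢𝐟⇒∃𝐭 g sup s≢𝐟 k =
    sup≢𝐟⇒∃≢𝐟 _ sup s≢𝐟 λ { (_ , (p , refl) , T≢𝐟) → k (p , T₃≢𝐟⇒≡𝐭 T≢𝐟) }

  quorum≢𝐟⇒∃open-≢𝐟 : ∀ (g : P → 𝟛) {q} → IsQuorum S g q → q ≢ 𝐟
                     → ¬ ¬ ∃ λ O → NonemptyOpen S O × (∀ p → O p → g p ≢ 𝐟)
  quorum≢𝐟⇒∃open-≢𝐟 g sup q≢𝐟 k =
    sup≢𝐟⇒∃≢𝐟 _ sup q≢𝐟 λ (w , (O , O≠∅ , (lower , _)) , w≢𝐟) →
    k (O , O≠∅ , λ p Op → ≤₃-resp-≢𝐟 (lower (g p) (p , Op , refl)) w≢𝐟)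

  contraquorum-𝐟-on-open : ∀ (g : P → 𝟛) {c O} → IsContraquorum S g c → NonemptyOpen S O
                         → (∀ p → O p → g p ≡ 𝐟) → ¬ ¬ (c ≡ 𝐟)
  contraquorum-𝐟-on-open g {c} (lower , _) O≠∅ 𝐟-on-O c≢𝐟 =
    sup-exists _ λ (w , supOn) →
    let w≡𝐟 = sup-of-all-𝐟 _ supOn λ { _ (p , Op , refl) → 𝐟-on-O p Op }
    in c≢𝐟 (x≤₃𝐟⇒x≡𝐟 (subst (c ≤₃_) w≡𝐟 (lower w (_ , O≠∅ , supOn))))

  correct-vote-forbids-quorums-of-both :
    ∀ (vote : P → 𝟛) → (∀ q → IsQuorum S (TF₃ ∘ vote) q → Valid q) → ThreeTwined
    → (∀ q → IsQuorum S vote q → Valid q) → (∀ q → IsQuorum S (¬₃ ∘ vote) q → Valid q) → ⊥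
  correct-vote-forbids-quorums-of-both vote correct twined vote-valid ¬vote-valid =
    sup-exists _ λ (q , Q) →
    sup-exists _ λ (q' , Q') →
    inf-exists _ λ (c , C) →
    sup-exists _ λ (qTF , QTF) →
    quorum≢𝐟⇒∃open-≢𝐟 (TF₃ ∘ vote) QTF (Valid⇒≢𝐟 (correct qTF QTF)) λ (O , O≠∅ , bivalent) →
    contraquorum-𝐟-on-open _ C O≠∅ (λ p Op → TF₃≢𝐟⇒x∧₃¬₃x≡𝐟 (bivalent p Op))
      (≤₃-resp-≢𝐟 (twined vote (¬₃ ∘ vote) q q' c Q Q' C)
        (∧₃-≢𝐟 (Valid⇒≢𝐟 (vote-valid q Q)) (Valid⇒≢𝐟 (¬vote-valid q' Q'))))

proposition2p23 : (S : Semitopology) (vote observe : Semitopology.P S → 𝟛)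
    → (∀ q → IsQuorum S vote q → ∀ p → Valid (observe p →w q))
    → (∀ q → IsQuorum S (¬₃ ∘ vote) q → ∀ p → Valid (¬₃ (observe p) →w q))
    → (∀ q → IsQuorum S vote q → ∀ p → Valid (q →s observe p))
    → (∀ q → IsQuorum S (¬₃ ∘ vote) q → ∀ p → Valid (q →s ¬₃ (observe p)))
    → (∀ q → IsQuorum S (TF₃ ∘ vote) q → Valid q)
    → (∀ (g h : Semitopology.P S → 𝟛) (q q' c : 𝟛) → IsQuorum S g q → IsQuorum S h q'
         → IsContraquorum S (_∧ᶠ_ S g h) c → (q ∧₃ q') ≤₃ c)
    → ∀ (s s' : 𝟛) → IsSomewhere S (T₃ ∘ observe) s → IsSomewhere S (T₃ ∘ ¬₃ ∘ observe) s'
    → (s ∧₃ s') ≡ 𝐟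
proposition2p23 S vote observe observe? observe¬? _ _ correct twined s s' hs hs' =
  ∧₃≡𝐟 λ (s≢𝐟 , s'≢𝐟) →
  somewhere-T₃≢𝐟⇒∃𝐭 S observe hs s≢𝐟 λ (p , observe-p≡𝐭) →
  somewhere-T₃≢𝐟⇒∃𝐭 S (¬₃ ∘ observe) hs' s'≢𝐟 λ (p' , ¬observe-p'≡𝐭) →
  correct-vote-forbids-quorums-of-both S vote correct twined
    (λ q Q → Valid-→w-𝐭 observe-p≡𝐭 (observe? q Q p))
    (λ q Q → Valid-→w-𝐭 ¬observe-p'≡𝐭 (observe¬? q Q p'))
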